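{- Let $r\geq 4$. Let $\mathcal{G}_r\subseteq\mathbb{R}^{\mathcal{P}([r])}$ be the set of all vectors $V$ of the form $V_T=(r-2|T|)(T(x)-T(y))$ for $T\subseteq[r]$, where $x,y$ are distinct elements of $[r]$ and $T(u)=1$ if $u\in T$, $T(u)=0$ otherwise. Then there exists a linearly independent subset $\mathcal{G}'_r\subseteq\mathcal{G}_r$ with $|\mathcal{G}'_r|\geq r-1$.
   Context: $\mathcal{P}([r])$ is the power set of $[r]=\{1,\ldots,r\}$.
   Formalization: The vectors have rational coordinates, in place of $\mathbb{R}^{\mathcal{P}([r])}$, and their linear independence is tested only against rational coefficients. -}

module Defs where

open import Data.Nat using (ℕ; zero; suc)
import Data.Nat as ℕ
open import Data.Fin using (Fin; zero; suc)
open import Data.Vec using (lookup)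
open import Data.Bool using (if_then_else_)
open import Data.Fin.Subset using (Subset; ∣_∣)
open import Data.Integer using (ℤ; +_; _-_)
import Data.Integer as ℤ
open import Data.Rational using (ℚ; 0ℚ; _/_; _+_; _*_)
open import Relation.Binary.PropositionalEquality using (_≡_)

ind : {r : ℕ} → Subset r → Fin r → ℤ
ind T u = if lookup T u then + 1 else + 0

gVec : (r : ℕ) → Fin r → Fin r → Subset r → ℚ
gVec r x y T = ((+ r - + (2 ℕ.* ∣ T ∣)) ℤ.* (ind T x - ind T y)) / 1

sumFin : (k : ℕ) → (Fin k → ℚ) → ℚ
sumFin zero    f = 0ℚ
sumFin (suc k) f = f zero + sumFin k (λ i → f (suc i))

LinIndep : (r k : ℕ) → (Fin k → Subset r → ℚ) → Set
LinIndep r k v =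
  (c : Fin k → ℚ) →
  ((T : Subset r) → sumFin k (λ i → c i * v i T) ≡ 0ℚ) →
  (i : Fin k) → c i ≡ 0ℚ

{-# OPTIONS --safe #-}
module Submission where

-- Take the r − 1 pairs (x , 0) with x ≠ 0. On a singleton T = {j} with j ≠ 0
-- the vector of (x , 0) takes the value (r − 2)·[x = j], so on these r − 1
-- coordinates the family is r − 2 times the identity matrix. Hence it is
-- linearly independent whenever r ≠ 2; the hypothesis r ≥ 4 is only used as r ≥ 3.

open import Defs
open import Data.Nat using (ℕ; _≤_; _∸_; zero; suc; s≤s; _+_)
open import Data.Nat.Properties using (≤-refl)
open import Data.Fin using (Fin; zero; suc)
open import Data.Fin.Properties using (suc-injective)
open import Data.Fin.Subset using (Subset; ⁅_⁆)
open import Data.Fin.Subset.Properties using (∣⁅x⁆∣≡1)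
open import Data.Vec.Properties using (lookup-replicate)
open import Data.Bool using (false)
open import Data.Product using (Σ; _×_; _,_; proj₁; proj₂; ∃-syntax)
open import Data.Integer using (+_)
import Data.Integer as ℤ
import Data.Integer.Properties as ℤ
open import Data.Rational using (ℚ; 0ℚ; 1ℚ; _/_; _*_; 1/_; NonZero)
import Data.Rational as ℚ
open import Data.Rational.Properties
  using (+-identityˡ; +-identityʳ; *-identityʳ; *-zeroˡ; *-zeroʳ; *-assoc; *-inverseʳ;
         pos⇒nonZero; normalize-pos)
open import Relation.Binary.PropositionalEquality
open import Function using (_∘_)
open import Relation.Nullary using (contradiction)

private
  variable
    k r : ℕ

sumFin-zero : (f : Fin k → ℚ) → (∀ i → f i ≡ 0ℚ) → sumFin k f ≡ 0ℚ
sumFin-zero {zero}  f f≡0 = refl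
sumFin-zero {suc k} f f≡0
  rewrite f≡0 zero | sumFin-zero (λ i → f (suc i)) (λ i → f≡0 (suc i)) = refl

sumFin-single : (f : Fin k → ℚ) (j : Fin k) → (∀ i → i ≢ j → f i ≡ 0ℚ) → sumFin k f ≡ f j
sumFin-single {suc k} f zero f≡0 =
  trans (cong (f zero ℚ.+_) (sumFin-zero (λ i → f (suc i)) (λ i → f≡0 (suc i) λ ())))
        (+-identityʳ (f zero))
sumFin-single {suc k} f (suc j) f≡0 =
  trans (cong (ℚ._+ sumFin k (λ i → f (suc i))) (f≡0 zero λ ()))
        (trans (+-identityˡ _)
               (sumFin-single (λ i → f (suc i)) j (λ i i≢j → f≡0 (suc i) (i≢j ∘ suc-injective))))

*-cancelʳ-≡0 : (p q : ℚ) .{{_ : NonZero q}} → p * q ≡ 0ℚ → p ≡ 0ℚ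
*-cancelʳ-≡0 p q pq≡0 = begin
  p                ≡⟨ sym (*-identityʳ p) ⟩
  p * 1ℚ           ≡⟨ cong (p *_) (sym (*-inverseʳ q)) ⟩
  p * (q * 1/ q)   ≡⟨ sym (*-assoc p q (1/ q)) ⟩
  (p * q) * 1/ q   ≡⟨ cong (_* 1/ q) pq≡0 ⟩
  0ℚ * 1/ q        ≡⟨ *-zeroˡ (1/ q) ⟩
  0ℚ               ∎
  where open ≡-Reasoning

diagonal⇒LinIndep : (v : Fin k → Subset r → ℚ) (t : Fin k → Subset r) →
                    (∀ {i j} → i ≢ j → v i (t j) ≡ 0ℚ) →
                    (∀ j → NonZero (v j (t j))) →
                    LinIndep r k v
diagonal⇒LinIndep {k} v t off-diagonal nonZero c Σcv≡0 j =
  *-cancelʳ-≡0 (c j) (v j (t j)) {{nonZero j}} (begin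
    c j * v j (t j)                    ≡⟨ sumFin-single (λ i → c i * v i (t j)) j cᵢvᵢ≡0 ⟨
    sumFin k (λ i → c i * v i (t j))   ≡⟨ Σcv≡0 (t j) ⟩
    0ℚ                                 ∎)
  where
  open ≡-Reasoning
  cᵢvᵢ≡0 : ∀ i → i ≢ j → c i * v i (t j) ≡ 0ℚ
  cᵢvᵢ≡0 i i≢j = trans (cong (c i *_) (off-diagonal i≢j)) (*-zeroʳ (c i))

ind-⁅x⁆-x : (x : Fin r) → ind ⁅ x ⁆ x ≡ + 1
ind-⁅x⁆-x zero    = refl
ind-⁅x⁆-x (suc x) = ind-⁅x⁆-x x

ind-⁅y⁆-x : {x y : Fin r} → x ≢ y → ind ⁅ y ⁆ x ≡ + 0
ind-⁅y⁆-x {x = zero}  {zero}  x≢y = contradiction refl x≢y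
ind-⁅y⁆-x {x = zero}  {suc y} x≢y = refl
ind-⁅y⁆-x {x = suc x} {zero}  x≢y rewrite lookup-replicate x false = refl
ind-⁅y⁆-x {x = suc x} {suc y} x≢y = ind-⁅y⁆-x (x≢y ∘ cong suc)

gVec-⁅⁆ : (x y z : Fin r) →
          gVec r x y ⁅ z ⁆ ≡ ((+ r ℤ.- + 2) ℤ.* (ind ⁅ z ⁆ x ℤ.- ind ⁅ z ⁆ y)) / 1
gVec-⁅⁆ x y z rewrite ∣⁅x⁆∣≡1 z = refl

gVec-star-⁅⁆ : (n : ℕ) (i j : Fin (2 + n)) →
               gVec (3 + n) (suc i) zero ⁅ suc j ⁆ ≡ (+ suc n ℤ.* ind ⁅ j ⁆ i) / 1
gVec-star-⁅⁆ n i j =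
  trans (gVec-⁅⁆ (suc i) zero (suc j))
        (cong (λ a → (+ suc n ℤ.* a) / 1) (ℤ.+-identityʳ (ind ⁅ j ⁆ i)))

gVec-star-LinIndep : (n : ℕ) → LinIndep (3 + n) (2 + n) (λ i → gVec (3 + n) (suc i) zero)
gVec-star-LinIndep n =
  diagonal⇒LinIndep (λ i → gVec (3 + n) (suc i) zero) (λ j → ⁅ suc j ⁆) off-diagonal nonZero
  where
  off-diagonal : ∀ {i j} → i ≢ j → gVec (3 + n) (suc i) zero ⁅ suc j ⁆ ≡ 0ℚ
  off-diagonal {i} {j} i≢j
    rewrite gVec-star-⁅⁆ n i j | ind-⁅y⁆-x i≢j | ℤ.*-zeroʳ (+ suc n) = refl

  diagonal : ∀ j → gVec (3 + n) (suc j) zero ⁅ suc j ⁆ ≡ + suc n / 1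
  diagonal j rewrite gVec-star-⁅⁆ n j j | ind-⁅x⁆-x j = cong (_/ 1) (ℤ.*-identityʳ (+ suc n))

  nonZero : ∀ j → NonZero (gVec (3 + n) (suc j) zero ⁅ suc j ⁆)
  nonZero j = subst NonZero (sym (diagonal j))
                    (pos⇒nonZero (+ suc n / 1) {{normalize-pos (suc n) 1}})

lemma7 : (r : ℕ) → 4 ≤ r →
    ∃[ k ] (r ∸ 1 ≤ k ×
      Σ (Fin k → Fin r × Fin r) λ p →
        ((i : Fin k) → proj₁ (p i) ≢ proj₂ (p i)) ×
        LinIndep r k (λ i → gVec r (proj₁ (p i)) (proj₂ (p i))))
lemma7 (suc (suc (suc n))) _ =
  2 + n , ≤-refl , (λ i → suc i , zero) , (λ i ()) , gVec-star-LinIndep n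
lemma7 1 (s≤s ())
lemma7 2 (s≤s (s≤s ()))
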